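{- Let $k,l,m,n\in\mathbb{N}$ with $m,n\geq 2$. Then $\mathfrak{U}_{k,m}\preccurlyeq\mathfrak{U}_{l,n}$ if and only if $m\leq n$ and $k+m\leq l+n$.
   Context: $\mathbb{N}=\{0,1,2,\ldots\}$ and $\mathbb{N}^\mathbb{N}$ is the semigroup of all maps $\mathbb{N}\to\mathbb{N}$ under composition. For $k,m\in\mathbb{N}$ with $m\geq 2$, $\mathfrak{U}_{k,m}$ is the set of all $f\in\mathbb{N}^\mathbb{N}$ such that $f(i)=i$ for $i<k$ and $f(i)\in\{k,k+1,\ldots,k+m-1\}$ for $i\geq k$. For $U,V\subseteq\mathbb{N}^\mathbb{N}$, $U\preccurlyeq V$ means there is a countable $C\subseteq\mathbb{N}^\mathbb{N}$ such that $U$ is contained in the subsemigroup generated by $V\cup C$. -}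

module Defs where

open import Data.Nat using (ℕ; _+_; _≤_; _<_)
open import Data.Product using (Σ; _×_)
open import Relation.Binary.PropositionalEquality using (_≡_)

-- Maps ℕ → ℕ; equality of maps is taken pointwise (no funext in Agda).
Map : Set
Map = ℕ → ℕ

_≗_ : Map → Map → Set
f ≗ g = ∀ i → f i ≡ g i

Subset : Set₁
Subset = Map → Set

𝔘 : ℕ → ℕ → Subset
𝔘 k m f = (∀ i → i < k → f i ≡ i) × (∀ i → k ≤ i → (k ≤ f i × f i < k + m))

-- Membership in the subsemigroup (under composition) generated by
-- V ∪ {c j | j ∈ ℕ}: finite nonempty composites of generators.
data Gen (V : Subset) (c : ℕ → Map) : Map → Set where
  gen-V    : ∀ {f g} → V g → f ≗ g → Gen V c f
  gen-C    : ∀ {f} j → f ≗ c j → Gen V c f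
  gen-comp : ∀ {f g h} → Gen V c g → Gen V c h → f ≗ (λ i → g (h i)) → Gen V c f

-- U ≼ V : there is a countable C ⊆ ℕ^ℕ (given as an enumeration c : ℕ → ℕ^ℕ)
-- with U contained in the subsemigroup generated by V ∪ C.
_≼_ : Subset → Subset → Set
U ≼ V = Σ (ℕ → Map) λ c → ∀ f → U f → Gen V c f

module Submission where

-- Sufficiency: writing p = min(k,l) and d = l ∸ k, every f ∈ 𝔘_{k,m} factors
-- as  unshift ∘ transport f ∘ shift-in  with transport f ∈ 𝔘_{l,n}, where
-- shift-in and unshift are two fixed maps (they make up the countable set C).
--
-- Necessity: an induction on generation shows that every map generated by
-- 𝔘_{l,n} ∪ C is either a word in C, or a word after a map with fewer than
-- l + n values, or a map taking at most n values on [l,∞) after a word.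
-- Since C is countable, its words can be enumerated, and a diagonal map
-- fD ∈ 𝔘_{k,m} reserves infinitely many positions for every word.  At the
-- first position fD differs from the word; at the remaining ones it answers
-- the values of the word by an online strategy (module Response) that no map
-- with at most n < m values on [l,∞) can follow.  Finally fD is the identity
-- on [0,k+m), so it cannot pass through fewer than k + m values.

open import Defs
open import Data.Nat
open import Data.Nat.Properties
open import Data.Bool using (Bool; true; false; _∨_; if_then_else_)
open import Data.Bool.Properties using (∨-zeroʳ)
open import Data.Product using (Σ; _×_; _,_; proj₁; proj₂; uncurry; map₁)
open import Data.Sum using (_⊎_; inj₁; inj₂; [_,_])
open import Data.List using (List; []; _∷_; _++_; length)
open import Data.Fin using (Fin; toℕ; fromℕ<)
open import Data.Fin.Properties using (pigeonhole; toℕ<n; toℕ-fromℕ<)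
open import Data.Empty using (⊥)
open import Function using (_∘_; id)
open import Function.Bundles using (_⇔_; mk⇔)
open import Relation.Nullary using (Dec; yes; no; does; ¬_)
open import Relation.Nullary.Decidable using (dec-true; dec-false; decidable-stable)
open import Relation.Binary.PropositionalEquality using (_≡_; _≢_; refl; sym; trans; cong; subst; module ≡-Reasoning)
open ≡-Reasoning

if-yes : ∀ {P A : Set} (d : Dec P) {a b : A} → P → (if does d then a else b) ≡ a
if-yes d p = cong (if_then _ else _) (dec-true d p)

if-no : ∀ {P A : Set} (d : Dec P) {a b : A} → ¬ P → (if does d then a else b) ≡ b
if-no d ¬p = cong (if_then _ else _) (dec-false d ¬p)

does-true : ∀ {P : Set} (d : Dec P) → does d ≡ true → P
does-true (yes p) _ = p

cut : ℕ → Map → Map → Map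
cut t g h i = if does (i <? t) then g i else h i

cut-< : ∀ {t i} g h → i < t → cut t g h i ≡ g i
cut-< {t} {i} _ _ = if-yes (i <? t)

cut-≥ : ∀ {t i} g h → t ≤ i → cut t g h i ≡ h i
cut-≥ {t} {i} _ _ t≤i = if-no (i <? t) (λ i<t → <⇒≱ i<t t≤i)

pigeonhole< : ∀ {A B} → B < A → (h : Fin A → ℕ) → (∀ i → h i < B) →
  Σ (Fin A) λ i → Σ (Fin A) λ j → toℕ i < toℕ j × h i ≡ h j
pigeonhole< B<A h h<B =
  let (i , j , i<j , e) = pigeonhole B<A (λ i → fromℕ< (h<B i))
  in i , j , i<j , trans (sym (toℕ-fromℕ< (h<B i))) (trans (cong toℕ e) (toℕ-fromℕ< (h<B j)))

𝔘-bounded : ∀ {k m f} → 𝔘 k m f → ∀ i → f i < k + m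
𝔘-bounded {k} {m} (fix , range) i with i <? k
... | yes i<k = subst (_< k + m) (sym (fix i i<k)) (≤-trans i<k (m≤m+n k m))
... | no i≮k = proj₂ (range i (≮⇒≥ i≮k))

𝔘-above : ∀ {k m f a i} → 𝔘 k m f → a ≤ k → a ≤ i → a ≤ f i
𝔘-above {k} {i = i} (fix , range) a≤k a≤i with i <? k
... | yes i<k = subst (_ ≤_) (sym (fix i i<k)) a≤i
... | no i≮k = ≤-trans a≤k (proj₁ (range i (≮⇒≥ i≮k)))

Bounded : ℕ → Map → Set
Bounded B g = ∀ i → g i < B

FewValuesAbove : ℕ → ℕ → Map → Set
FewValuesAbove l n H = Σ Map λ P → ∀ v → l ≤ v → Σ ℕ λ y → y < n × H v ≡ P y

fewValues-∘ : ∀ {l n H} h → FewValuesAbove l n H → FewValuesAbove l n (h ∘ H)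
fewValues-∘ h (P , few) = h ∘ P , λ v l≤v →
  let (y , y<n , e) = few v l≤v in y , y<n , cong h e

𝔘-fewValues : ∀ {l n g} → 𝔘 l n g → FewValuesAbove l n g
𝔘-fewValues {l} {n} {g} (_ , range) = (l +_) , λ v l≤v →
  let (l≤gv , gv<l+n) = range v l≤v
  in g v ∸ l , subst (g v ∸ l <_) (m+n∸m≡n l n) (∸-monoˡ-< gv<l+n l≤gv) ,
     sym (m+[n∸m]≡n l≤gv)

fewValues-missing : ∀ {l n m H} → FewValuesAbove l n H → n < m →
  ¬ (∀ (u : Fin m) → Σ ℕ λ v → l ≤ v × H v ≡ toℕ u)
fewValues-missing {H = H} (P , few) n<m attained =
  let (u₁ , u₂ , u₁<u₂ , e) = pigeonhole< n<m label label<n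
  in <⇒≢ u₁<u₂ (begin
       toℕ u₁           ≡⟨ value u₁ ⟩
       P (label u₁)     ≡⟨ cong P e ⟩
       P (label u₂)     ≡⟨ value u₂ ⟨
       toℕ u₂           ∎)
  where
    few-at : ∀ u → Σ ℕ λ y → y < _ × H (proj₁ (attained u)) ≡ P y
    few-at u = few (proj₁ (attained u)) (proj₁ (proj₂ (attained u)))
    label : Fin _ → ℕ
    label u = proj₁ (few-at u)
    label<n : ∀ u → label u < _
    label<n u = proj₁ (proj₂ (few-at u))
    value : ∀ u → toℕ u ≡ P (label u)
    value u = trans (sym (proj₂ (proj₂ (attained u)))) (proj₂ (proj₂ (few-at u)))

identity-no-factor : ∀ {A B f g} h → (∀ i → i < A → f i ≡ i) → B < A → Bounded B g →
  ¬ (f ≗ (h ∘ g))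
identity-no-factor {f = f} {g} h fix B<A g<B f≗hg =
  let (i , j , i<j , e) = pigeonhole< B<A (g ∘ toℕ) (g<B ∘ toℕ)
  in <⇒≢ i<j (begin
       toℕ i            ≡⟨ fix (toℕ i) (toℕ<n i) ⟨
       f (toℕ i)        ≡⟨ f≗hg (toℕ i) ⟩
       h (g (toℕ i))    ≡⟨ cong h e ⟩
       h (g (toℕ j))    ≡⟨ f≗hg (toℕ j) ⟨
       f (toℕ j)        ≡⟨ fix (toℕ j) (toℕ<n j) ⟩
       toℕ j            ∎)

module Sufficiency (k l m n : ℕ) (m≤n : m ≤ n) (k+m≤l+n : k + m ≤ l + n) where

  -- Below p both families are the identity; shifting by d carries the
  -- range [k, k+m) of 𝔘_{k,m} into the range [l, l+n) of 𝔘_{l,n}.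
  p d : ℕ
  p = k ⊓ l
  d = l ∸ k

  p+d≡l : p + d ≡ l
  p+d≡l = m⊓n+n∸m≡n k l

  k+m+d≤l+n : k + m + d ≤ l + n
  k+m+d≤l+n with k ≤? l
  ... | yes k≤l = ≤-trans (≤-reflexive (begin
    k + m + (l ∸ k)    ≡⟨ +-assoc k m (l ∸ k) ⟩
    k + (m + (l ∸ k))  ≡⟨ cong (k +_) (+-comm m (l ∸ k)) ⟩
    k + ((l ∸ k) + m)  ≡⟨ +-assoc k (l ∸ k) m ⟨
    k + (l ∸ k) + m    ≡⟨ cong (_+ m) (m+[n∸m]≡n k≤l) ⟩
    l + m              ∎)) (+-monoʳ-≤ l m≤n)
  ... | no k≰l = subst (λ e → k + m + e ≤ l + n) (sym (m≤n⇒m∸n≡0 (<⇒≤ (≰⇒> k≰l))))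
                   (subst (_≤ l + n) (sym (+-identityʳ (k + m))) k+m≤l+n)

  shift-in unshift : Map
  shift-in = cut p id (_+ d)
  unshift = cut l id (_∸ d)

  transport : Map → Map
  transport f = cut l id (λ j → f (j ∸ d) + d)

  shift-in-< : ∀ {i} → i < p → shift-in i ≡ i
  shift-in-< = cut-< id (_+ d)

  shift-in-≥ : ∀ {i} → p ≤ i → shift-in i ≡ i + d
  shift-in-≥ = cut-≥ id (_+ d)

  unshift-< : ∀ {j} → j < l → unshift j ≡ j
  unshift-< = cut-< id (_∸ d)

  unshift-≥ : ∀ {j} → l ≤ j → unshift j ≡ j ∸ d
  unshift-≥ = cut-≥ id (_∸ d)

  transport-< : ∀ f {j} → j < l → transport f j ≡ j
  transport-< f = cut-< id (λ j → f (j ∸ d) + d)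

  transport-≥ : ∀ f {j} → l ≤ j → transport f j ≡ f (j ∸ d) + d
  transport-≥ f = cut-≥ id (λ j → f (j ∸ d) + d)

  module _ {f : Map} (f∈𝔘 : 𝔘 k m f) where
    -- f keeps [p,∞) inside [p,∞), so the shifted values stay in [l,∞).
    shifted-large : ∀ {i} → p ≤ i → l ≤ f i + d
    shifted-large {i} p≤i = subst (_≤ f i + d) p+d≡l (+-monoˡ-≤ d (𝔘-above f∈𝔘 (m⊓n≤m k l) p≤i))

    transport-𝔘 : 𝔘 l n (transport f)
    transport-𝔘 = (λ j j<l → transport-< f j<l) , λ j l≤j →
      let p≤j∸d = subst (_≤ j ∸ d) (trans (cong (_∸ d) (sym p+d≡l)) (m+n∸n≡m p d))
                        (∸-monoˡ-≤ d l≤j)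
          value<l+n = ≤-trans (+-monoˡ-< d (𝔘-bounded f∈𝔘 (j ∸ d))) k+m+d≤l+n
      in subst (λ z → l ≤ z × z < l + n) (sym (transport-≥ f l≤j)) (shifted-large p≤j∸d , value<l+n)

    transport-factor : ∀ i → unshift (transport f (shift-in i)) ≡ f i
    transport-factor i with i <? p
    ... | yes i<p = begin
      unshift (transport f (shift-in i))  ≡⟨ cong (unshift ∘ transport f) (shift-in-< i<p) ⟩
      unshift (transport f i)             ≡⟨ cong unshift (transport-< f i<l) ⟩
      unshift i                           ≡⟨ unshift-< i<l ⟩
      i                                   ≡⟨ proj₁ f∈𝔘 i (<-≤-trans i<p (m⊓n≤m k l)) ⟨
      f i                                 ∎
      where i<l = <-≤-trans i<p (m⊓n≤n k l)
    ... | no i≮p = begin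
      unshift (transport f (shift-in i))  ≡⟨ cong (unshift ∘ transport f) (shift-in-≥ p≤i) ⟩
      unshift (transport f (i + d))       ≡⟨ cong unshift (transport-≥ f l≤i+d) ⟩
      unshift (f (i + d ∸ d) + d)         ≡⟨ cong (λ z → unshift (f z + d)) (m+n∸n≡m i d) ⟩
      unshift (f i + d)                   ≡⟨ unshift-≥ (shifted-large p≤i) ⟩
      f i + d ∸ d                         ≡⟨ m+n∸n≡m (f i) d ⟩
      f i                                 ∎
      where p≤i = ≮⇒≥ i≮p
            l≤i+d = subst (_≤ i + d) p+d≡l (+-monoˡ-≤ d p≤i)

  sufficiency : 𝔘 k m ≼ 𝔘 l n
  sufficiency = generators , λ f f∈𝔘 →
    gen-comp (gen-C 0 (λ _ → refl))
             (gen-comp (gen-V (transport-𝔘 f∈𝔘) (λ _ → refl)) (gen-C 1 (λ _ → refl)) (λ _ → refl))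
             (λ i → sym (transport-factor f∈𝔘 i))
    where
      generators : ℕ → Map
      generators zero = unshift
      generators (suc _) = shift-in

ev : (ℕ → Map) → List ℕ → Map
ev c [] x = x
ev c (j ∷ w) x = c j (ev c w x)

ev-++ : ∀ c u w x → ev c (u ++ w) x ≡ ev c u (ev c w x)
ev-++ c [] w x = refl
ev-++ c (j ∷ u) w x = cong (c j) (ev-++ c u w x)

Pure : (ℕ → Map) → Map → Set
Pure c f = Σ (List ℕ) λ w → f ≗ ev c w

ev-∘ : ∀ {c g h q} u w → g ≗ ev c u → h ≗ (ev c w ∘ q) → (λ i → g (h i)) ≗ (ev c (u ++ w) ∘ q)
ev-∘ {c} {g} {h} {q} u w g≗u h≗wq i = begin
  g (h i)              ≡⟨ g≗u (h i) ⟩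
  ev c u (h i)         ≡⟨ cong (ev c u) (h≗wq i) ⟩
  ev c u (ev c w (q i)) ≡⟨ ev-++ c u w (q i) ⟨
  ev c (u ++ w) (q i)  ∎

gen-word-after-Q : ∀ {V Q : Subset} {c} → (∀ {g} → V g → Q g) → (∀ {g} h → Q g → Q (g ∘ h)) →
  ∀ {f} → Gen V c f → Pure c f ⊎ Σ (List ℕ) λ w → Σ Map λ q → Q q × f ≗ (ev c w ∘ q)
gen-word-after-Q V⊆Q Q-∘ (gen-V {g = g} g∈V f≗g) = inj₂ ([] , g , V⊆Q g∈V , f≗g)
gen-word-after-Q V⊆Q Q-∘ (gen-C j f≗cj) = inj₁ (j ∷ [] , f≗cj)
gen-word-after-Q V⊆Q Q-∘ (gen-comp {g = g} {h} G H f≗gh)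
  with gen-word-after-Q V⊆Q Q-∘ G | gen-word-after-Q V⊆Q Q-∘ H
... | inj₂ (u , q , q∈Q , g≗uq) | _ =
  inj₂ (u , q ∘ h , Q-∘ h q∈Q , λ i → trans (f≗gh i) (g≗uq (h i)))
... | inj₁ (u , g≗u) | inj₁ (w , h≗w) =
  inj₁ (u ++ w , λ i → trans (f≗gh i) (ev-∘ {q = id} u w g≗u h≗w i))
... | inj₁ (u , g≗u) | inj₂ (w , q , q∈Q , h≗wq) =
  inj₂ (u ++ w , q , q∈Q , λ i → trans (f≗gh i) (ev-∘ u w g≗u h≗wq i))

gen-Q-after-word : ∀ {V Q : Subset} {c} → (∀ {g} → V g → Q g) → (∀ {g} h → Q g → Q (h ∘ g)) →
  ∀ {f} → Gen V c f → Pure c f ⊎ Σ (List ℕ) λ w → Σ Map λ q → Q q × f ≗ (q ∘ ev c w)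
gen-Q-after-word V⊆Q Q-∘ (gen-V {g = g} g∈V f≗g) = inj₂ ([] , g , V⊆Q g∈V , f≗g)
gen-Q-after-word V⊆Q Q-∘ (gen-C j f≗cj) = inj₁ (j ∷ [] , f≗cj)
gen-Q-after-word {c = c} V⊆Q Q-∘ {f} (gen-comp {g = g} {h} G H f≗gh)
  with gen-Q-after-word V⊆Q Q-∘ G | gen-Q-after-word V⊆Q Q-∘ H
... | _ | inj₂ (w , q , q∈Q , h≗qw) =
  inj₂ (w , g ∘ q , Q-∘ g q∈Q , λ i → trans (f≗gh i) (cong g (h≗qw i)))
... | inj₁ (u , g≗u) | inj₁ (w , h≗w) =
  inj₁ (u ++ w , λ i → trans (f≗gh i) (ev-∘ {q = id} u w g≗u h≗w i))
... | inj₂ (u , q , q∈Q , g≗qu) | inj₁ (w , h≗w) =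
  inj₂ (u ++ w , q , q∈Q , λ i → begin
    f i                   ≡⟨ f≗gh i ⟩
    g (h i)               ≡⟨ g≗qu (h i) ⟩
    q (ev c u (h i))      ≡⟨ cong (q ∘ ev c u) (h≗w i) ⟩
    q (ev c u (ev c w i)) ≡⟨ cong q (ev-++ c u w i) ⟨
    q (ev c (u ++ w) i)   ∎)

Enumerates : {A : Set} → (ℕ → A) → Set
Enumerates {A} e = ∀ (a : A) → Σ ℕ λ x → e x ≡ a

-- Enumeration of ℕ × ℕ along the anti-diagonals.
next : ℕ × ℕ → ℕ × ℕ
next (a , zero) = zero , suc a
next (a , suc b) = suc a , b

unpair : ℕ → ℕ × ℕ
unpair zero = zero , zero
unpair (suc x) = next (unpair x)

Hit : ℕ × ℕ → Set
Hit q = Σ ℕ λ x → unpair x ≡ q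

hit-next : ∀ {q} → Hit q → Hit (next q)
hit-next (x , e) = suc x , cong next e

hit-diagonal : ∀ c a b → Hit (a , c + b) → Hit (a + c , b)
hit-diagonal zero a b h = subst (λ z → Hit (z , b)) (sym (+-identityʳ a)) h
hit-diagonal (suc c) a b h =
  subst (λ z → Hit (z , b)) (sym (+-suc a c)) (hit-diagonal c (suc a) b (hit-next h))

hit-axis : ∀ b → Hit (zero , b)
hit-axis zero = zero , refl
hit-axis (suc b) = hit-next (hit-diagonal b zero zero
                     (subst (λ z → Hit (zero , z)) (sym (+-identityʳ b)) (hit-axis b)))

-- The pair (a , b) lies on the anti-diagonal starting at (0 , a + b).
unpair-enumerates : Enumerates unpair
unpair-enumerates (a , b) = hit-diagonal a zero b (hit-axis (a + b))

decodeList : ℕ → ℕ → List ℕ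
decodeList zero x = []
decodeList (suc L) x = proj₁ (unpair x) ∷ decodeList L (proj₂ (unpair x))

decodeList-enumerates : ∀ w → Σ ℕ λ x → decodeList (length w) x ≡ w
decodeList-enumerates [] = zero , refl
decodeList-enumerates (a ∷ w) with decodeList-enumerates w
... | y , e with unpair-enumerates (a , y)
... | x , e′ = x , (begin
  proj₁ (unpair x) ∷ decodeList (length w) (proj₂ (unpair x)) ≡⟨ cong (λ q → proj₁ q ∷ decodeList (length w) (proj₂ q)) e′ ⟩
  a ∷ decodeList (length w) y                                 ≡⟨ cong (a ∷_) e ⟩
  a ∷ w                                                       ∎)

decodeWord : ℕ → List ℕ
decodeWord = uncurry decodeList ∘ unpair

decodeWord-enumerates : Enumerates decodeWord
decodeWord-enumerates w =
  let (y , e) = decodeList-enumerates w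
      (j , e′) = unpair-enumerates (length w , y)
  in j , trans (cong (uncurry decodeList) e′) e

decode : ℕ → List ℕ × ℕ
decode = map₁ decodeWord ∘ unpair

decode-enumerates : Enumerates decode
decode-enumerates (w , r) =
  let (j , e) = decodeWord-enumerates w
      (x , e′) = unpair-enumerates (j , r)
  in x , trans (cong (map₁ decodeWord) e′) (cong (_, r) e)

-- An online strategy answering a sequence x by values below m, which no map
-- with fewer than m values on [l,∞) can follow.
module Response (l m : ℕ) (2≤m : 2 ≤ m) (x : ℕ → ℕ) where

  -- Step s is large when x s lies in [l,∞), where the opponent has few values.
  Large : ℕ → Set
  Large s = l ≤ x s

  large# : ℕ → ℕ
  large# zero = zero
  large# (suc s) = if does (l ≤? x s) then suc (large# s) else large# s

  seen : ℕ → ℕ → Bool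
  seen zero v = false
  seen (suc s) v = seen s v ∨ does (x s ≟ v)

  respond : ℕ → ℕ
  respond s = if does (l ≤? x s) then pred m ⊓ large# s else (if seen s (x s) then 1 else 0)

  respond-large : ∀ {s} → Large s → respond s ≡ pred m ⊓ large# s
  respond-large {s} = if-yes (l ≤? x s)

  respond-small : ∀ {s} → ¬ Large s → respond s ≡ (if seen s (x s) then 1 else 0)
  respond-small {s} = if-no (l ≤? x s)

  respond<m : ∀ s → respond s < m
  respond<m s with l ≤? x s
  ... | yes large = subst (_< m) (sym (respond-large large)) (m<n⇒m⊓o<n (large# s) pred<m)
    where pred<m = ≤-reflexive (suc-pred m {{>-nonZero (≤-trans (s≤s z≤n) 2≤m)}})
  ... | no small = subst (_< m) (sym (respond-small small)) (bit<m (seen s (x s)))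
    where bit<m : ∀ b → (if b then 1 else 0) < m
          bit<m true = 2≤m
          bit<m false = ≤-trans (s≤s z≤n) 2≤m

  large#-large : ∀ {s} → Large s → large# (suc s) ≡ suc (large# s)
  large#-large {s} = if-yes (l ≤? x s)

  large#-small : ∀ {s} → ¬ Large s → large# (suc s) ≡ large# s
  large#-small {s} = if-no (l ≤? x s)

  large#-mono : ∀ {s s′} → s ≤ s′ → large# s ≤ large# s′
  large#-mono {s′ = zero} z≤n = ≤-refl
  large#-mono {s} {suc s′} s≤1+s′ with m≤n⇒m<n∨m≡n s≤1+s′
  ... | inj₂ refl = ≤-refl
  ... | inj₁ s<1+s′ = ≤-trans (large#-mono (≤-pred s<1+s′)) step
    where
      step : large# s′ ≤ large# (suc s′)
      step with l ≤? x s′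
      ... | yes large = subst (large# s′ ≤_) (sym (large#-large large)) (n≤1+n _)
      ... | no small = ≤-reflexive (sym (large#-small small))

  large#-strict : ∀ {s s′} → s < s′ → Large s → large# s < large# s′
  large#-strict s<s′ large = subst (_≤ _) (large#-large large) (large#-mono s<s′)

  large#-hits : ∀ {u s} → u < large# s → Σ ℕ λ s′ → s′ < s × Large s′ × large# s′ ≡ u
  large#-hits {u} {suc s} u<# with l ≤? x s
  ... | no small =
    let (s′ , s′<s , large′ , e) = large#-hits (subst (u <_) (large#-small small) u<#)
    in s′ , m<n⇒m<1+n s′<s , large′ , e
  ... | yes large with u <? large# s
  ...   | yes u<#′ = let (s′ , s′<s , large′ , e) = large#-hits u<#′
                     in s′ , m<n⇒m<1+n s′<s , large′ , e
  ...   | no u≮#′ = s , ≤-refl , large ,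
                    ≤-antisym (≮⇒≥ u≮#′) (≤-pred (subst (u <_) (large#-large large) u<#))

  seen-intro : ∀ {s s′} → s < s′ → seen s′ (x s) ≡ true
  seen-intro {s} {suc s′} (s≤s s≤s′) with m≤n⇒m<n∨m≡n s≤s′
  ... | inj₁ s<s′ = cong (_∨ does (x s′ ≟ x s)) (seen-intro s<s′)
  ... | inj₂ refl = trans (cong (seen s (x s) ∨_) (dec-true (x s ≟ x s) refl)) (∨-zeroʳ _)

  seen-first : ∀ {s v} → seen s v ≡ true → Σ ℕ λ s₀ → s₀ < s × x s₀ ≡ v × seen s₀ v ≡ false
  seen-first {suc s} {v} e with seen s v in earlier
  ... | true = let (s₀ , s₀<s , e₀ , first) = seen-first earlier
               in s₀ , m<n⇒m<1+n s₀<s , e₀ , first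
  ... | false = s , ≤-refl , does-true (x s ≟ v) e , earlier

  code : ℕ → ℕ
  code s = if does (l ≤? x s) then l + respond s else x s

  code-large : ∀ {s} → Large s → code s ≡ l + respond s
  code-large {s} = if-yes (l ≤? x s)

  code-small : ∀ {s} → ¬ Large s → code s ≡ x s
  code-small {s} = if-no (l ≤? x s)

  code<l+m : ∀ s → code s < l + m
  code<l+m s with l ≤? x s
  ... | yes large = subst (_< l + m) (sym (code-large large)) (+-monoʳ-< l (respond<m s))
  ... | no small = subst (_< l + m) (sym (code-small small)) (≤-trans (≰⇒> small) (m≤m+n l m))

  module Follower {n H} (n<m : n < m) (few : FewValuesAbove l n H)
                  (follows : ∀ s → H (x s) ≡ respond s) where

    -- The count never reaches m - 1 at a large step: H would attain all of
    -- 0, …, m - 1 on [l,∞).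
    unsaturated : ∀ {s} → Large s → large# s < pred m
    unsaturated {s} large = ≰⇒> λ saturated → fewValues-missing few n<m (attained saturated)
      where
        attained : pred m ≤ large# s → ∀ (u : Fin m) → Σ ℕ λ v → l ≤ v × H v ≡ toℕ u
        attained saturated u with toℕ u <? pred m
        ... | yes u<pred =
          let (s′ , _ , large′ , e) = large#-hits {s = s} (<-≤-trans u<pred saturated)
          in x s′ , large′ , (begin
            H (x s′)             ≡⟨ follows s′ ⟩
            respond s′           ≡⟨ respond-large large′ ⟩
            pred m ⊓ large# s′   ≡⟨ cong (pred m ⊓_) e ⟩
            pred m ⊓ toℕ u       ≡⟨ m≥n⇒m⊓n≡n (<⇒≤ u<pred) ⟩
            toℕ u                ∎)
        ... | no u≮pred = x s , large , (begin
            H (x s)              ≡⟨ follows s ⟩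
            respond s            ≡⟨ respond-large large ⟩
            pred m ⊓ large# s    ≡⟨ m≤n⇒m⊓n≡m saturated ⟩
            pred m               ≡⟨ ≤-antisym (<⇒≤pred (toℕ<n u)) (≮⇒≥ u≮pred) ⟨
            toℕ u                ∎)

    -- A small value never recurs: it is answered 0 first and 1 afterwards.
    small-once : ∀ {s s′} → s < s′ → x s ≡ x s′ → ¬ Large s′ → ⊥
    small-once {s} {s′} s<s′ e small =
      let (s₀ , _ , e₀ , first) = seen-first {s′} again
          small₀ = subst (λ v → ¬ (l ≤ v)) (sym e₀) small
      in 0≢1+n (begin
        0                                  ≡⟨ cong (if_then 1 else 0) first ⟨
        (if seen s₀ (x s′) then 1 else 0)  ≡⟨ cong (λ v → if seen s₀ v then 1 else 0) e₀ ⟨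
        (if seen s₀ (x s₀) then 1 else 0)  ≡⟨ respond-small small₀ ⟨
        respond s₀                         ≡⟨ follows s₀ ⟨
        H (x s₀)                           ≡⟨ cong H e₀ ⟩
        H (x s′)                           ≡⟨ follows s′ ⟩
        respond s′                         ≡⟨ respond-small small ⟩
        (if seen s′ (x s′) then 1 else 0)  ≡⟨ cong (if_then 1 else 0) again ⟩
        1                                  ∎)
      where
        again : seen s′ (x s′) ≡ true
        again = subst (λ v → seen s′ v ≡ true) e (seen-intro {s} s<s′)

    code-injective : ∀ {s s′} → s < s′ → code s ≢ code s′
    code-injective {s} {s′} s<s′ e with l ≤? x s | l ≤? x s′
    ... | yes large | yes large′ = <⇒≢ (large#-strict s<s′ large) (begin
      large# s         ≡⟨ answer {s} large ⟨
      respond s        ≡⟨ +-cancelˡ-≡ l _ _ (trans (sym (code-large large)) (trans e (code-large large′))) ⟩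
      respond s′       ≡⟨ answer {s′} large′ ⟩
      large# s′        ∎)
      where
        answer : ∀ {t} → Large t → respond t ≡ large# t
        answer large = trans (respond-large large) (m≥n⇒m⊓n≡n (<⇒≤ (unsaturated large)))
    ... | yes large | no small′ =
      small′ (subst (l ≤_) (trans (sym (code-large large)) (trans e (code-small small′))) (m≤m+n l _))
    ... | no small | yes large′ =
      small (subst (l ≤_) (trans (sym (code-large large′)) (trans (sym e) (code-small small))) (m≤m+n l _))
    ... | no small | no small′ =
      small-once s<s′ (trans (sym (code-small small)) (trans e (code-small small′))) small′

    -- Among the first l + m + 1 steps two codes below l + m must coincide.
    impossible : ⊥
    impossible =
      let (s , s′ , s<s′ , e) = pigeonhole< (n<1+n (l + m)) (code ∘ toℕ) (code<l+m ∘ toℕ)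
      in code-injective s<s′ e

  escapes : ∀ {n H} → n < m → FewValuesAbove l n H → ¬ (∀ s → H (x s) ≡ respond s)
  escapes n<m few follows = Follower.impossible n<m few follows

-- A map fD ∈ 𝔘_{k,m} that escapes the semigroup generated by 𝔘_{l,n} ∪ C
-- whenever m > n or k + m > l + n.
module Diagonal (k l m : ℕ) (2≤m : 2 ≤ m) (c : ℕ → Map) where

  -- Slot r of the word w: a position past k + m reserved for defeating w.
  slot : List ℕ → ℕ → ℕ
  slot w r = k + m + proj₁ (decode-enumerates (w , r))

  trace : List ℕ → ℕ → ℕ
  trace w s = ev c w (slot w (suc s))

  dodge : ℕ → ℕ
  dodge v = if does (v ≟ k) then 1 else 0

  k+dodge≢ : ∀ v → k + dodge v ≢ v
  k+dodge≢ v e with v ≟ k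
  ... | yes v≡k = m+1+n≢m k (trans (sym (cong (k +_) (if-yes (v ≟ k) v≡k))) (trans e v≡k))
  ... | no v≢k = v≢k (trans (sym e) (trans (cong (k +_) (if-no (v ≟ k) v≢k)) (+-identityʳ k)))

  value : List ℕ × ℕ → ℕ
  value (w , zero) = dodge (ev c w (slot w zero))
  value (w , suc s) = Response.respond l m 2≤m (trace w) s

  value<m : ∀ q → value q < m
  value<m (w , zero) = dodge<m (ev c w (slot w zero))
    where dodge<m : ∀ v → dodge v < m
          dodge<m v with v ≟ k
          ... | yes v≡k = subst (_< m) (sym (if-yes (v ≟ k) v≡k)) 2≤m
          ... | no v≢k = subst (_< m) (sym (if-no (v ≟ k) v≢k)) (≤-trans (s≤s z≤n) 2≤m)
  value<m (w , suc s) = Response.respond<m l m 2≤m (trace w) s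

  fD : Map
  fD = cut (k + m) id (λ i → k + value (decode (i ∸ (k + m))))

  fD-fixes : ∀ {i} → i < k + m → fD i ≡ i
  fD-fixes = cut-< id (λ i → k + value (decode (i ∸ (k + m))))

  fD-above : ∀ {i} → k + m ≤ i → fD i ≡ k + value (decode (i ∸ (k + m)))
  fD-above = cut-≥ id (λ i → k + value (decode (i ∸ (k + m))))

  fD-slot : ∀ w r → fD (slot w r) ≡ k + value (w , r)
  fD-slot w r = begin
    fD (slot w r)                                   ≡⟨ fD-above (m≤m+n (k + m) _) ⟩
    k + value (decode (slot w r ∸ (k + m)))         ≡⟨ cong (λ i → k + value (decode i)) (m+n∸m≡n (k + m) _) ⟩
    k + value (decode (proj₁ (decode-enumerates (w , r)))) ≡⟨ cong (λ q → k + value q) (proj₂ (decode-enumerates (w , r))) ⟩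
    k + value (w , r)                               ∎

  fD-𝔘 : 𝔘 k m fD
  fD-𝔘 = (λ i i<k → fD-fixes (≤-trans i<k (m≤m+n k m))) , range
    where
      range : ∀ i → k ≤ i → k ≤ fD i × fD i < k + m
      range i k≤i with i <? k + m
      ... | yes i<k+m = subst (λ z → k ≤ z × z < k + m) (sym (fD-fixes i<k+m)) (k≤i , i<k+m)
      ... | no i≮k+m = subst (λ z → k ≤ z × z < k + m) (sym (fD-above (≮⇒≥ i≮k+m)))
                             (m≤m+n k _ , +-monoʳ-< k (value<m (decode (i ∸ (k + m)))))

  -- fD is not a word: at slot 0 of w it differs from w.
  fD-not-word : ¬ Pure c fD
  fD-not-word (w , fD≗w) = k+dodge≢ _ (trans (sym (fD-slot w zero)) (fD≗w (slot w zero)))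

  fD-not-narrow : ∀ {B} → B < k + m → ¬ (Σ (List ℕ) λ w → Σ Map λ g → Bounded B g × fD ≗ (ev c w ∘ g))
  fD-not-narrow B<k+m (w , g , bounded , fD≗wg) =
    identity-no-factor (ev c w) (λ _ → fD-fixes) B<k+m bounded fD≗wg

  -- fD is not a word followed by a map with fewer than m values on [l,∞):
  -- subtracting k, that map would follow the answers to the trace of the word.
  fD-not-few : ∀ {n} → n < m → ¬ (Σ (List ℕ) λ w → Σ Map λ H → FewValuesAbove l n H × fD ≗ (H ∘ ev c w))
  fD-not-few n<m (w , H , few , fD≗Hw) =
    Response.escapes l m 2≤m (trace w) n<m (fewValues-∘ (_∸ k) few) follows
    where
      open Response l m 2≤m (trace w) using (respond)
      follows : ∀ s → H (trace w s) ∸ k ≡ respond s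
      follows s = begin
        H (trace w s) ∸ k        ≡⟨ cong (_∸ k) (fD≗Hw (slot w (suc s))) ⟨
        fD (slot w (suc s)) ∸ k  ≡⟨ cong (_∸ k) (fD-slot w (suc s)) ⟩
        k + respond s ∸ k        ≡⟨ m+n∸m≡n k (respond s) ⟩
        respond s                ∎

lemma5p2 : (k l m n : ℕ) → 2 ≤ m → 2 ≤ n →
    ((𝔘 k m ≼ 𝔘 l n) ⇔ (m ≤ n × k + m ≤ l + n))
lemma5p2 k l m n 2≤m _ = mk⇔ necessity (uncurry (Sufficiency.sufficiency k l m n))
  where
    necessity : 𝔘 k m ≼ 𝔘 l n → m ≤ n × k + m ≤ l + n
    necessity (c , 𝔘⊆⟨𝔘∪C⟩) = m≤n , k+m≤l+n
      where
        open Diagonal k l m 2≤m c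
        fD-generated : Gen (𝔘 l n) c fD
        fD-generated = 𝔘⊆⟨𝔘∪C⟩ fD fD-𝔘
        -- If m > n, fD would be a word or a map with n < m values on [l,∞) after a word.
        m≤n : m ≤ n
        m≤n = decidable-stable (m ≤? n) λ m≰n →
          [ fD-not-word , fD-not-few (≰⇒> m≰n) ]
            (gen-Q-after-word 𝔘-fewValues fewValues-∘ fD-generated)
        -- If k + m > l + n, fD would be a word or a word after a map with l + n values.
        k+m≤l+n : k + m ≤ l + n
        k+m≤l+n = decidable-stable (k + m ≤? l + n) λ k+m≰l+n →
          [ fD-not-word , fD-not-narrow (≰⇒> k+m≰l+n) ]
            (gen-word-after-Q (𝔘-bounded {l}) (λ h g-bounded → g-bounded ∘ h) fD-generated)
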